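{- Let $q$ be odd. For $\epsilon\in\mathbb{F}_{q^3}^*$ consider the matrix $$A_\epsilon=\begin{pmatrix} 2\epsilon+\epsilon^q+\epsilon^{q^2} & (\epsilon+\epsilon^{q^2})^q & (\epsilon+\epsilon^q)^{q^2}\\ \epsilon+\epsilon^q & (2\epsilon+\epsilon^q+\epsilon^{q^2})^q & (\epsilon+\epsilon^{q^2})^{q^2}\\ \epsilon+\epsilon^{q^2} & (\epsilon+\epsilon^q)^q & (2\epsilon+\epsilon^q+\epsilon^{q^2})^{q^2} \end{pmatrix}.$$ Then $\det(A_\epsilon)\neq 0$ for all $\epsilon\in\mathbb{F}_{q^3}^*$.
   Context: $q$ is a power of an odd prime. -}

module Defs where

open import Level using (Level; _⊔_; suc)
open import Data.Nat using (ℕ; zero; suc)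
open import Data.Fin using (Fin)
open import Data.Product using (Σ; _×_)
open import Relation.Nullary using (¬_)
open import Algebra.Bundles using (CommutativeRing)
open import Function.Bundles using (Inverse)
import Relation.Binary.PropositionalEquality as P

record Field (c ℓ : Level) : Set (Level.suc (c ⊔ ℓ)) where
  field
    commutativeRing : CommutativeRing c ℓ
  open CommutativeRing commutativeRing public
  field
    1≉0 : ¬ (1# ≈ 0#)
    inverse : ∀ x → ¬ (x ≈ 0#) → Σ Carrier (λ y → (x * y) ≈ 1#)

module _ {c ℓ : Level} (F : Field c ℓ) where
  open Field F

  pow : Carrier → ℕ → Carrier
  pow x zero = 1#
  pow x (suc n) = x * pow x n

  -- determinant of a 3x3 matrix given row by row (Leibniz formula)
  det3 : Carrier → Carrier → Carrier →
         Carrier → Carrier → Carrier →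
         Carrier → Carrier → Carrier → Carrier
  det3 a b c d e f g h i =
    ((a * (e * i)) + ((b * (f * g)) + (c * (d * h))))
    - ((c * (e * g)) + ((b * (d * i)) + (a * (f * h))))

  HasCard : ℕ → Set (c ⊔ ℓ)
  HasCard n = Inverse setoid (P.setoid (Fin n))

  detA : ℕ → Carrier → Carrier
  detA q ε = det3
      s                 (pow u q)        (pow v (q2))
      v                 (pow s q)        (pow u (q2))
      u                 (pow v q)        (pow s (q2))
    where
      q2 = q Data.Nat.* q
      eq = pow ε q
      eq2 = pow ε q2
      s = (ε + ε) + (eq + eq2)
      u = ε + eq2
      v = ε + eq

{-# OPTIONS --safe #-}
-- Counting through the bijection F ≅ Fin q³: translations permute F, so q³·x = 0, and
-- multiplying by x ≠ 0 permutes the nonzero elements, so x^(q³) = x. Hence p·1 = 0, and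
-- since p divides the inner binomial coefficients, φ(x) = x^q is additive. With a = ε,
-- b = ε^q, c = ε^(q²), φ permutes a, b, c cyclically, so every entry of A_ε is a sum of
-- a, b, c and det A_ε = 4(a+b)(b+c)(c+a). As q is odd, 2 ≠ 0. If a + b = 0 then
-- b + c = φ(a + b) = 0, so a = c, b = φ(a) = φ(c) = a and 2a = 0, contradicting ε ≠ 0;
-- rotating (a, b, c) handles the other two factors.
module Submission where

open import Defs
open import Level using (Level; _⊔_)
open import Algebra.Bundles using (CommutativeMonoid)
open import Algebra.Core using (Op₁)
import Algebra.Properties.CommutativeMonoid.Sum
open import Data.Empty using (⊥-elim)
open import Data.Fin as Fin using (Fin)
open import Data.Fin.Permutation using (Permutation′)
open import Data.Fin.Properties using (punchInᵢ≢i; toℕ-fromℕ; toℕ-inject₁; toℕ<n)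
open import Data.Nat as ℕ using (ℕ; zero; suc; _<_; _∸_; _!; z<s; s≤s; NonZero)
open import Data.Nat.Combinatorics using (_C_; nCn≡1; nCk≡n!/k![n-k]!; k![n∸k]!∣n!)
open import Data.Nat.Divisibility using (_∣_; _∤_; divides; m∣m*n; >⇒∤)
open import Data.Nat.DivMod using (_/_; _%_; m*n/n≡m; m≡m%n+[m/n]*n; m%n<n)
open import Data.Nat.Primality using (Prime; euclidsLemma; prime⇒nonZero; prime⇒nonTrivial; prime⇒irreducible)
import Data.Nat.Properties as ℕₚ
open import Data.Nat.Properties using (^-*-assoc; n∸n≡0; <⇒≤; <-trans; n<1+n; ∸-monoʳ-<; _!*_!≢0)
open import Data.Product using (∃-syntax; _,_)
open import Data.Sum using ([_,_]′; inj₁; inj₂)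
open import Data.Vec.Functional using (Vector; removeAt)
open import Function using (_∘_; id)
open import Function.Bundles using (Inverse)
import Function.Construct.Composition as Composition
import Function.Construct.Symmetry as Symmetry
open import Function.Definitions using (Congruent)
open import Relation.Binary.Bundles using (Setoid)
open import Relation.Binary.Definitions using (Decidable)
open import Relation.Binary.PropositionalEquality using (_≡_; _≢_)
import Relation.Binary.PropositionalEquality as ≡
open import Relation.Nullary using (¬_)
open import Relation.Nullary.Decidable using (map′; yes; no)

prime∤! : ∀ {p} → Prime p → ∀ {m} → m < p → p ∤ m !
prime∤! {p} p-prime {zero}  _   = >⇒∤ (ℕ.nonTrivial⇒n>1 p {{prime⇒nonTrivial p-prime}})
prime∤! p-prime {suc m} m<p p∣m! with euclidsLemma (suc m) (m !) p-prime p∣m!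
... | inj₁ p∣1+m = >⇒∤ m<p p∣1+m
... | inj₂ p∣m!  = prime∤! p-prime (<-trans (n<1+n m) m<p) p∣m!

prime∣pCk : ∀ {p k} → Prime p → 0 < k → k < p → p ∣ p C k
prime∣pCk {p} {k} p-prime 0<k k<p with k![n∸k]!∣n! (<⇒≤ k<p)
... | divides d p!≡d*k![p∸k]! = ≡.subst (p ∣_) (≡.sym pCk≡d) p∣d
  where
  instance
    k![p∸k]!≢0 : NonZero (k ! ℕ.* (p ∸ k) !)
    k![p∸k]!≢0 = k !* (p ∸ k) !≢0
  open ≡.≡-Reasoning
  pCk≡d : p C k ≡ d
  pCk≡d = begin
    p C k                                             ≡⟨ nCk≡n!/k![n-k]! (<⇒≤ k<p) ⟩
    p ! / (k ! ℕ.* (p ∸ k) !)                         ≡⟨ ≡.cong (_/ _) p!≡d*k![p∸k]! ⟩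
    d ℕ.* (k ! ℕ.* (p ∸ k) !) / (k ! ℕ.* (p ∸ k) !)   ≡⟨ m*n/n≡m d _ ⟩
    d                                                 ∎
  n∣n! : ∀ n → .{{NonZero n}} → n ∣ n !
  n∣n! (suc n) = m∣m*n (n !)
  p∤k![p∸k]! : p ∤ k ! ℕ.* (p ∸ k) !
  p∤k![p∸k]! = [ prime∤! p-prime k<p , prime∤! p-prime (∸-monoʳ-< 0<k (<⇒≤ k<p)) ]′
             ∘ euclidsLemma _ _ p-prime
  p∣d : p ∣ d
  p∣d = [ id , ⊥-elim ∘ p∤k![p∸k]! ]′ (euclidsLemma d _ p-prime p∣d*k![p∸k]!)
    where
    p∣d*k![p∸k]! : p ∣ d ℕ.* (k ! ℕ.* (p ∸ k) !)
    p∣d*k![p∸k]! = ≡.subst (p ∣_) p!≡d*k![p∸k]! (n∣n! p {{prime⇒nonZero p-prime}})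

n*n*n≡n^3 : ∀ n → n ℕ.* n ℕ.* n ≡ n ℕ.^ 3
n*n*n≡n^3 n = ≡.trans (ℕₚ.*-assoc n n n) (≡.cong (λ m → n ℕ.* (n ℕ.* m)) (≡.sym (ℕₚ.*-identityʳ n)))

prime≢2⇒odd : ∀ {p} → Prime p → p ≢ 2 → ∃[ h ] p ≡ suc (h ℕ.* 2)
prime≢2⇒odd {p} p-prime p≢2 with p % 2 | m≡m%n+[m/n]*n p 2 | m%n<n p 2
... | 0           | p≡[p/2]*2   | _ =
  ⊥-elim ([ (λ ()) , p≢2 ∘ ≡.sym ]′ (prime⇒irreducible p-prime (divides (p / 2) p≡[p/2]*2)))
... | 1           | p≡1+[p/2]*2 | _ = p / 2 , p≡1+[p/2]*2
... | suc (suc _) | _           | s≤s (s≤s ())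

module _ {a ℓₐ : Level} {S : Setoid a ℓₐ} where
  open Setoid S

  automorphism : (σ σ⁻¹ : Op₁ Carrier) → Congruent _≈_ _≈_ σ → Congruent _≈_ _≈_ σ⁻¹ →
                 (∀ x → σ (σ⁻¹ x) ≈ x) → (∀ x → σ⁻¹ (σ x) ≈ x) → Inverse S S
  automorphism σ σ⁻¹ σ-cong σ⁻¹-cong σσ⁻¹ σ⁻¹σ = record
    { to        = σ
    ; from      = σ⁻¹
    ; to-cong   = σ-cong
    ; from-cong = σ⁻¹-cong
    ; inverse   = (λ y≈σ⁻¹x → trans (σ-cong y≈σ⁻¹x) (σσ⁻¹ _))
                , (λ y≈σx → trans (σ⁻¹-cong y≈σx) (σ⁻¹σ _))
    }

  ≈-dec : ∀ {N} → Inverse S (≡.setoid (Fin N)) → Decidable _≈_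
  ≈-dec card x y = map′ (λ tx≡ty → trans (sym (strictlyInverseʳ x)) (inverseʳ tx≡ty)) to-cong (to x Fin.≟ to y)
    where open Inverse card

module _ {c ℓ : Level} (M : CommutativeMonoid c ℓ) where
  open CommutativeMonoid M
  open Algebra.Properties.CommutativeMonoid.Sum M using (sum; sum-remove; sum-permute; sum-cong-≋; sum-replicate-zero)
  open import Relation.Binary.Reasoning.Setoid setoid

  sum-single : ∀ {n} (t : Vector Carrier n) i → (∀ j → j ≢ i → t j ≈ ε) → sum t ≈ t i
  sum-single {suc n} t i t≈ε = begin
    sum t                       ≈⟨ sum-remove t ⟩
    t i ∙ sum (removeAt t i)    ≈⟨ ∙-congˡ (sum-cong-≋ (λ j → t≈ε (Fin.punchIn i j) (punchInᵢ≢i i j))) ⟩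
    t i ∙ sum {n} (λ _ → ε)     ≈⟨ ∙-congˡ (sum-replicate-zero n) ⟩
    t i ∙ ε                     ≈⟨ identityʳ (t i) ⟩
    t i                         ∎

  sum-invariant : ∀ {a ℓₐ} {S : Setoid a ℓₐ} {N} (card : Inverse S (≡.setoid (Fin N))) (σ : Inverse S S) →
                  (f : Setoid.Carrier S → Carrier) → Congruent (Setoid._≈_ S) _≈_ f →
                  sum (f ∘ Inverse.from card) ≈ sum (f ∘ Inverse.to σ ∘ Inverse.from card)
  sum-invariant {N = N} card σ f f-cong = begin
    sum (f ∘ from)                        ≈⟨ sum-permute (f ∘ from) π ⟩
    sum (f ∘ from ∘ to ∘ σ.to ∘ from)     ≈⟨ sum-cong-≋ (λ i → f-cong (strictlyInverseʳ (σ.to (from i)))) ⟩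
    sum (f ∘ σ.to ∘ from)                 ∎
    where
    open Inverse card
    module σ = Inverse σ
    π : Permutation′ N
    π = Composition.inverse (Composition.inverse (Symmetry.inverse card) σ) card

module FieldProperties {c ℓ : Level} (F : Field c ℓ) where
  open Field F hiding (inverse)
  open import Algebra.Definitions _≈_ using (Congruent₁)
  open import Algebra.Properties.Semiring.Exp semiring using (_^_; ^-congˡ; ^-assocʳ)
  open import Algebra.Properties.Semiring.Mult semiring using (_×_; ×-homo-1; ×-congʳ; ×-assoc-*; ×1-homo-*)
  import Algebra.Properties.CommutativeSemiring.Binomial commutativeSemiring as Binomial
  open import Relation.Binary.Reasoning.Setoid setoid

  *-cancelʳ : ∀ {x y z} → z ≉ 0# → x * z ≈ y * z → x ≈ y
  *-cancelʳ {x} {y} {z} z≉0 xz≈yz with Field.inverse F z z≉0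
  ... | z⁻¹ , zz⁻¹≈1 = begin
    x               ≈⟨ *-identityʳ x ⟨
    x * 1#          ≈⟨ *-congˡ zz⁻¹≈1 ⟨
    x * (z * z⁻¹)   ≈⟨ *-assoc x z z⁻¹ ⟨
    x * z * z⁻¹     ≈⟨ *-congʳ xz≈yz ⟩
    y * z * z⁻¹     ≈⟨ *-assoc y z z⁻¹ ⟩
    y * (z * z⁻¹)   ≈⟨ *-congˡ zz⁻¹≈1 ⟩
    y * 1#          ≈⟨ *-identityʳ y ⟩
    y               ∎

  x≉0∧y≉0⇒x*y≉0 : ∀ {x y} → x ≉ 0# → y ≉ 0# → x * y ≉ 0#
  x≉0∧y≉0⇒x*y≉0 {x} {y} x≉0 y≉0 xy≈0 =
    y≉0 (*-cancelʳ x≉0 (trans (*-comm y x) (trans xy≈0 (sym (zeroˡ x)))))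

  x≉0⇒x^n≉0 : ∀ {x} n → x ≉ 0# → x ^ n ≉ 0#
  x≉0⇒x^n≉0 zero    _   = 1≉0
  x≉0⇒x^n≉0 (suc n) x≉0 = x≉0∧y≉0⇒x*y≉0 x≉0 (x≉0⇒x^n≉0 n x≉0)

  1+1≉0⇒x+x≉0 : 1# + 1# ≉ 0# → ∀ {x} → x ≉ 0# → x + x ≉ 0#
  1+1≉0⇒x+x≉0 1+1≉0 {x} x≉0 x+x≈0 = x≉0∧y≉0⇒x*y≉0 1+1≉0 x≉0 (begin
    (1# + 1#) * x   ≈⟨ distribʳ x 1# 1# ⟩
    1# * x + 1# * x ≈⟨ +-cong (*-identityˡ x) (*-identityˡ x) ⟩
    x + x           ≈⟨ x+x≈0 ⟩
    0#              ∎)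

  m×x≈[m×1]*x : ∀ m x → m × x ≈ (m × 1#) * x
  m×x≈[m×1]*x m x = begin
    m × x           ≈⟨ ×-congʳ m (*-identityˡ x) ⟨
    m × (1# * x)    ≈⟨ ×-assoc-* m 1# x ⟨
    (m × 1#) * x    ∎

  private
    module Σ = Algebra.Properties.CommutativeMonoid.Sum +-commutativeMonoid
    module Π = Algebra.Properties.CommutativeMonoid.Sum *-commutativeMonoid

  ∏≉0 : ∀ {n} (t : Vector Carrier n) → (∀ i → t i ≉ 0#) → Π.sum t ≉ 0#
  ∏≉0 {zero}  t t≉0 = 1≉0
  ∏≉0 {suc n} t t≉0 = x≉0∧y≉0⇒x*y≉0 (t≉0 Fin.zero) (∏≉0 (t ∘ Fin.suc) (t≉0 ∘ Fin.suc))

  [m^n]×1≈[m×1]^n : ∀ m n → (m ℕ.^ n) × 1# ≈ (m × 1#) ^ n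
  [m^n]×1≈[m×1]^n m zero    = +-identityʳ 1#
  [m^n]×1≈[m×1]^n m (suc n) = trans (×1-homo-* m (m ℕ.^ n)) (*-congˡ ([m^n]×1≈[m×1]^n m n))

  module Finite {N : ℕ} (card : HasCard F N) where
    open Inverse card using (to; from; to-cong; strictlyInverseˡ; strictlyInverseʳ)
    open import Algebra.Properties.AbelianGroup +-abelianGroup using (identityˡ-unique; \\-leftDividesˡ; \\-leftDividesʳ)

    N×x≈0 : ∀ x → N × x ≈ 0#
    N×x≈0 x = identityˡ-unique (N × x) (Σ.sum from) (sym (begin
      Σ.sum from                       ≈⟨ sum-invariant +-commutativeMonoid card +x id id ⟩
      Σ.sum (λ i → x + from i)         ≈⟨ Σ.∑-distrib-+ (λ _ → x) from ⟩
      Σ.sum {N} (λ _ → x) + Σ.sum from ≈⟨ +-congʳ (Σ.sum-replicate N) ⟩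
      N × x + Σ.sum from               ∎))
      where
      +x : Inverse setoid setoid
      +x = automorphism (x +_) (- x +_) +-congˡ +-congˡ (\\-leftDividesˡ x) (\\-leftDividesʳ x)

    m^n≡N⇒m×1≈0 : ∀ {m n} → m ℕ.^ n ≡ N → m × 1# ≈ 0#
    m^n≡N⇒m×1≈0 {m} {n} m^n≡N with ≈-dec card (m × 1#) 0#
    ... | yes m×1≈0 = m×1≈0
    ... | no  m×1≉0 = ⊥-elim (x≉0⇒x^n≉0 n m×1≉0 (begin
      (m × 1#) ^ n      ≈⟨ [m^n]×1≈[m×1]^n m n ⟨
      (m ℕ.^ n) × 1#    ≡⟨ ≡.cong (_× 1#) m^n≡N ⟩
      N × 1#            ≈⟨ N×x≈0 1# ⟩
      0#                ∎))

    -- The product of nonzeroOrOne over F is the product of the nonzero elements of F.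
    nonzeroOrOne : Op₁ Carrier
    nonzeroOrOne y with ≈-dec card y 0#
    ... | yes _ = 1#
    ... | no  _ = y

    nonzeroOrOne≉0 : ∀ y → nonzeroOrOne y ≉ 0#
    nonzeroOrOne≉0 y with ≈-dec card y 0#
    ... | yes _   = 1≉0
    ... | no  y≉0 = y≉0

    nonzeroOrOne-cong : ∀ {y z} → y ≈ z → nonzeroOrOne y ≈ nonzeroOrOne z
    nonzeroOrOne-cong {y} {z} y≈z with ≈-dec card y 0# | ≈-dec card z 0#
    ... | yes _   | yes _   = refl
    ... | no  _   | no  _   = y≈z
    ... | yes y≈0 | no  z≉0 = ⊥-elim (z≉0 (trans (sym y≈z) y≈0))
    ... | no  y≉0 | yes z≈0 = ⊥-elim (y≉0 (trans y≈z z≈0))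

    ifZero : Carrier → Carrier → Carrier
    ifZero x y with ≈-dec card y 0#
    ... | yes _ = x
    ... | no  _ = 1#

    x*nonzeroOrOne[y]≈nonzeroOrOne[xy]*ifZero[x,y] : ∀ {x} → x ≉ 0# → ∀ y →
      x * nonzeroOrOne y ≈ nonzeroOrOne (x * y) * ifZero x y
    x*nonzeroOrOne[y]≈nonzeroOrOne[xy]*ifZero[x,y] {x} x≉0 y
      with ≈-dec card y 0# | ≈-dec card (x * y) 0#
    ... | yes _   | yes _    = *-comm x 1#
    ... | no  _   | no  _    = sym (*-identityʳ (x * y))
    ... | yes y≈0 | no  xy≉0 = ⊥-elim (xy≉0 (trans (*-congˡ y≈0) (zeroʳ x)))
    ... | no  y≉0 | yes xy≈0 = ⊥-elim (x≉0∧y≉0⇒x*y≉0 x≉0 y≉0 xy≈0)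

    ∏ifZero≈x : ∀ x → Π.sum (ifZero x ∘ from) ≈ x
    ∏ifZero≈x x = begin
      Π.sum (ifZero x ∘ from)   ≈⟨ sum-single *-commutativeMonoid (ifZero x ∘ from) (to 0#) from[j]≈1 ⟩
      ifZero x (from (to 0#))   ≈⟨ ifZero[0]≈x ⟩
      x                         ∎
      where
      ifZero[0]≈x : ifZero x (from (to 0#)) ≈ x
      ifZero[0]≈x with ≈-dec card (from (to 0#)) 0#
      ... | yes _          = refl
      ... | no  from[to0]≉0 = ⊥-elim (from[to0]≉0 (strictlyInverseʳ 0#))
      from[j]≈1 : ∀ j → j ≢ to 0# → ifZero x (from j) ≈ 1#
      from[j]≈1 j j≢to0 with ≈-dec card (from j) 0#
      ... | yes from[j]≈0 = ⊥-elim (j≢to0 (≡.trans (≡.sym (strictlyInverseˡ j)) (to-cong from[j]≈0)))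
      ... | no  _         = refl

    x^N≈x : ∀ {x} → x ≉ 0# → x ^ N ≈ x
    x^N≈x {x} x≉0 with Field.inverse F x x≉0
    ... | x⁻¹ , xx⁻¹≈1 = *-cancelʳ (∏≉0 (nonzeroOrOne ∘ from) (nonzeroOrOne≉0 ∘ from)) (begin
      x ^ N * ∏                                   ≈⟨ *-congʳ (Π.sum-replicate N) ⟨
      Π.sum {N} (λ _ → x) * ∏                     ≈⟨ Π.∑-distrib-+ (λ _ → x) (nonzeroOrOne ∘ from) ⟨
      Π.sum (λ i → x * nonzeroOrOne (from i))     ≈⟨ Π.sum-cong-≋ (x*nonzeroOrOne[y]≈nonzeroOrOne[xy]*ifZero[x,y] x≉0 ∘ from) ⟩
      Π.sum (λ i → nonzeroOrOne (x * from i) * ifZero x (from i))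
        ≈⟨ Π.∑-distrib-+ (nonzeroOrOne ∘ (x *_) ∘ from) (ifZero x ∘ from) ⟩
      Π.sum (nonzeroOrOne ∘ (x *_) ∘ from) * Π.sum (ifZero x ∘ from)
        ≈⟨ *-cong (sym (sum-invariant *-commutativeMonoid card x* nonzeroOrOne nonzeroOrOne-cong)) (∏ifZero≈x x) ⟩
      ∏ * x                                       ≈⟨ *-comm ∏ x ⟩
      x * ∏                                       ∎)
      where
      ∏ : Carrier
      ∏ = Π.sum (nonzeroOrOne ∘ from)
      x* : Inverse setoid setoid
      x* = automorphism (x *_) (x⁻¹ *_) *-congˡ *-congˡ
        (λ y → trans (sym (*-assoc x x⁻¹ y)) (trans (*-congʳ xx⁻¹≈1) (*-identityˡ y)))
        (λ y → trans (sym (*-assoc x⁻¹ x y)) (trans (*-congʳ (trans (*-comm x⁻¹ x) xx⁻¹≈1)) (*-identityˡ y)))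

  Additive : Op₁ Carrier → Set (c ⊔ ℓ)
  Additive f = ∀ x y → f (x + y) ≈ f x + f y

  ^1-additive : Additive (_^ 1)
  ^1-additive x y = trans (*-identityʳ (x + y)) (sym (+-cong (*-identityʳ x) (*-identityʳ y)))

  ^-*-additive : ∀ {m n} → Additive (_^ m) → Additive (_^ n) → Additive (_^ (m ℕ.* n))
  ^-*-additive {m} {n} ^m-additive ^n-additive x y = begin
    (x + y) ^ (m ℕ.* n)           ≈⟨ ^-assocʳ (x + y) m n ⟨
    ((x + y) ^ m) ^ n             ≈⟨ ^-congˡ n (^m-additive x y) ⟩
    (x ^ m + y ^ m) ^ n           ≈⟨ ^n-additive (x ^ m) (y ^ m) ⟩
    (x ^ m) ^ n + (y ^ m) ^ n     ≈⟨ +-cong (^-assocʳ x m n) (^-assocʳ y m n) ⟩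
    x ^ (m ℕ.* n) + y ^ (m ℕ.* n) ∎

  binomials≈0⇒^n-additive : ∀ n → .{{NonZero n}} → (∀ {k} → 0 < k → k < n → (n C k) × 1# ≈ 0#) → Additive (_^ n)
  binomials≈0⇒^n-additive (suc m) inner≈0 x y = begin
    (x + y) ^ suc m                                         ≈⟨ Binomial.theorem (suc m) x y ⟩
    t Fin.zero + Σ.sum (t ∘ Fin.suc)                        ≈⟨ +-congˡ (Σ.sum-init-last (t ∘ Fin.suc)) ⟩
    t Fin.zero + (Σ.sum inner + t (Fin.suc (Fin.fromℕ m)))  ≈⟨ +-cong first (+-cong inner-sum≈0 last) ⟩
    y ^ suc m + (0# + x ^ suc m)                            ≈⟨ +-congˡ (+-identityˡ (x ^ suc m)) ⟩
    y ^ suc m + x ^ suc m                                   ≈⟨ +-comm (y ^ suc m) (x ^ suc m) ⟩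
    x ^ suc m + y ^ suc m                                   ∎
    where
    t : Vector Carrier (suc (suc m))
    t = Binomial.binomialTerm x y (suc m)
    inner : Vector Carrier m
    inner = t ∘ Fin.suc ∘ Fin.inject₁
    first : t Fin.zero ≈ y ^ suc m
    first = trans (×-homo-1 _) (*-identityˡ _)
    last : t (Fin.suc (Fin.fromℕ m)) ≈ x ^ suc m
    last rewrite toℕ-fromℕ m | nCn≡1 (suc m) | n∸n≡0 m = trans (×-homo-1 _) (*-identityʳ _)
    inner-sum≈0 : Σ.sum inner ≈ 0#
    inner-sum≈0 = trans (Σ.sum-cong-≋ inner-term≈0) (Σ.sum-replicate-zero m)
      where
      inner-term≈0 : ∀ i → inner i ≈ 0#
      inner-term≈0 i = trans (m×x≈[m×1]*x (suc m C k) _) (trans (*-congʳ (inner≈0 z<s (s≤s i<m))) (zeroˡ _))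
        where
        k : ℕ
        k = suc (Fin.toℕ (Fin.inject₁ i))
        i<m : Fin.toℕ (Fin.inject₁ i) < m
        i<m = ≡.subst (_< m) (≡.sym (toℕ-inject₁ i)) (toℕ<n i)

  module Characteristic {p : ℕ} (p-prime : Prime p) (p×1≈0 : p × 1# ≈ 0#) where

    p∣m⇒m×1≈0 : ∀ {m} → p ∣ m → m × 1# ≈ 0#
    p∣m⇒m×1≈0 (divides d ≡.refl) = begin
      (d ℕ.* p) × 1#          ≈⟨ ×1-homo-* d p ⟩
      (d × 1#) * (p × 1#)     ≈⟨ *-congˡ p×1≈0 ⟩
      (d × 1#) * 0#           ≈⟨ zeroʳ (d × 1#) ⟩
      0#                      ∎

    ^p-additive : Additive (_^ p)
    ^p-additive = binomials≈0⇒^n-additive p {{prime⇒nonZero p-prime}}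
      (λ 0<k k<p → p∣m⇒m×1≈0 (prime∣pCk p-prime 0<k k<p))

    ^pᵏ-additive : ∀ k → Additive (_^ (p ℕ.^ k))
    ^pᵏ-additive zero    = ^1-additive
    ^pᵏ-additive (suc k) = ^-*-additive {p} ^p-additive (^pᵏ-additive k)

    1+1≉0 : p ≢ 2 → 1# + 1# ≉ 0#
    1+1≉0 p≢2 1+1≈0 with prime≢2⇒odd p-prime p≢2
    ... | h , p≡1+h*2 = 1≉0 (begin
      1#                      ≈⟨ +-identityʳ 1# ⟨
      1# + 0#                 ≈⟨ +-congˡ [h*2]×1≈0 ⟨
      1# + (h ℕ.* 2) × 1#     ≡⟨ ≡.cong (_× 1#) p≡1+h*2 ⟨
      p × 1#                  ≈⟨ p×1≈0 ⟩
      0#                      ∎)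
      where
      [h*2]×1≈0 : (h ℕ.* 2) × 1# ≈ 0#
      [h*2]×1≈0 = begin
        (h ℕ.* 2) × 1#        ≈⟨ ×1-homo-* h 2 ⟩
        (h × 1#) * (1# + (1# + 0#)) ≈⟨ *-congˡ (trans (+-congˡ (+-identityʳ 1#)) 1+1≈0) ⟩
        (h × 1#) * 0#         ≈⟨ zeroʳ (h × 1#) ⟩
        0#                    ∎

  det3-cong : ∀ {a b c d e f g h i a′ b′ c′ d′ e′ f′ g′ h′ i′} →
    a ≈ a′ → b ≈ b′ → c ≈ c′ → d ≈ d′ → e ≈ e′ → f ≈ f′ → g ≈ g′ → h ≈ h′ → i ≈ i′ →
    det3 F a b c d e f g h i ≈ det3 F a′ b′ c′ d′ e′ f′ g′ h′ i′
  det3-cong a b c d e f g h i =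
    +-cong (+-cong (*-cong a (*-cong e i)) (+-cong (*-cong b (*-cong f g)) (*-cong c (*-cong d h))))
           (-‿cong (+-cong (*-cong c (*-cong e g)) (+-cong (*-cong b (*-cong d i)) (*-cong a (*-cong f h)))))

  det3≈4[a+b][b+c][c+a] : ∀ a b c → let X = (a + b) * ((b + c) * (c + a)) in
    det3 F ((a + a) + (b + c)) (b + a)               (c + a)
           (a + b)             ((b + b) + (c + a))   (c + b)
           (a + c)             (b + c)               ((c + c) + (a + b))
    ≈ (X + X) + (X + X)
  -- The ℕ-coefficient solver has no subtraction: it equates the positive terms of the
  -- Leibniz formula with 4X plus the negative ones.
  det3≈4[a+b][b+c][c+a] a b c = trans (+-congʳ (solve 3 (λ a b c →
      let s₁ = (a :+ a) :+ (b :+ c); s₂ = (b :+ b) :+ (c :+ a); s₃ = (c :+ c) :+ (a :+ b)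
          X  = (a :+ b) :* ((b :+ c) :* (c :+ a))
      in (s₁ :* (s₂ :* s₃)) :+ (((b :+ a) :* ((c :+ b) :* (a :+ c))) :+ ((c :+ a) :* ((a :+ b) :* (b :+ c))))
         := ((X :+ X) :+ (X :+ X))
            :+ (((c :+ a) :* (s₂ :* (a :+ c))) :+ (((b :+ a) :* ((a :+ b) :* s₃)) :+ (s₁ :* ((c :+ b) :* (b :+ c))))))
      refl a b c))
    (//-rightDividesʳ _ _)
    where
    open import Algebra.Properties.AbelianGroup +-abelianGroup using (//-rightDividesʳ)
    open import Algebra.Solver.Ring.NaturalCoefficients.Default commutativeSemiring using (solve; _:+_; _:*_; _:=_)

  -- With φ = (_^ q), ψ = (_^ q²), a = ε, b = ε ^ q and c = ε ^ q², detA F q ε unfolds to orbitDet φ ψ a b c.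
  orbitDet : (φ ψ : Op₁ Carrier) (a b c : Carrier) → Carrier
  orbitDet φ ψ a b c = det3 F s (φ u) (ψ v) v (φ s) (ψ u) u (φ v) (ψ s)
    where
    s u v : Carrier
    s = (a + a) + (b + c)
    u = a + c
    v = a + b

  module _ {φ : Op₁ Carrier} (φ-cong : Congruent₁ φ) (φ-additive : Additive φ) where
    open import Algebra.Properties.AbelianGroup +-abelianGroup using (inverseˡ-unique; inverseʳ-unique)
    open import Algebra.Properties.Ring ring using (x+x≈x⇒x≈0)

    φ0≈0 : φ 0# ≈ 0#
    φ0≈0 = x+x≈x⇒x≈0 (φ 0#) (trans (sym (φ-additive 0# 0#)) (φ-cong (+-identityʳ 0#)))

    φ-+-≈ : ∀ {x y x′ y′} → φ x ≈ x′ → φ y ≈ y′ → φ (x + y) ≈ x′ + y′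
    φ-+-≈ φx≈x′ φy≈y′ = trans (φ-additive _ _) (+-cong φx≈x′ φy≈y′)

    module _ {a b c : Carrier} (φa≈b : φ a ≈ b) (φb≈c : φ b ≈ c) (φc≈a : φ c ≈ a) where

      orbit-a+b≉0 : 1# + 1# ≉ 0# → a ≉ 0# → a + b ≉ 0#
      orbit-a+b≉0 1+1≉0 a≉0 a+b≈0 = 1+1≉0⇒x+x≉0 1+1≉0 a≉0 (trans (+-congˡ (sym b≈a)) a+b≈0)
        where
        b+c≈0 : b + c ≈ 0#
        b+c≈0 = trans (sym (φ-+-≈ φa≈b φb≈c)) (trans (φ-cong a+b≈0) φ0≈0)
        a≈c : a ≈ c
        a≈c = trans (inverseˡ-unique a b a+b≈0) (sym (inverseʳ-unique b c b+c≈0))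
        b≈a : b ≈ a
        b≈a = trans (sym φa≈b) (trans (φ-cong a≈c) φc≈a)

      orbitDet≈4[a+b][b+c][c+a] : ∀ {ψ} → (∀ x → ψ x ≈ φ (φ x)) →
        let X = (a + b) * ((b + c) * (c + a)) in orbitDet φ ψ a b c ≈ (X + X) + (X + X)
      orbitDet≈4[a+b][b+c][c+a] {ψ} ψ≈φ² = trans
        (det3-cong refl φ[a+c] (ψ≈ φ[a+b] φ[b+c])
                   refl (φ-+-≈ (φ-+-≈ φa≈b φa≈b) φ[b+c]) (ψ≈ φ[a+c] (φ-+-≈ φb≈c φa≈b))
                   refl φ[a+b] (ψ≈ (φ-+-≈ (φ-+-≈ φa≈b φa≈b) φ[b+c]) (φ-+-≈ (φ-+-≈ φb≈c φb≈c) φ[c+a])))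
        (det3≈4[a+b][b+c][c+a] a b c)
        where
        ψ≈ : ∀ {x y z} → φ x ≈ y → φ y ≈ z → ψ x ≈ z
        ψ≈ φx≈y φy≈z = trans (ψ≈φ² _) (trans (φ-cong φx≈y) φy≈z)
        φ[a+b] : φ (a + b) ≈ b + c
        φ[a+b] = φ-+-≈ φa≈b φb≈c
        φ[b+c] : φ (b + c) ≈ c + a
        φ[b+c] = φ-+-≈ φb≈c φc≈a
        φ[c+a] : φ (c + a) ≈ a + b
        φ[c+a] = φ-+-≈ φc≈a φa≈b
        φ[a+c] : φ (a + c) ≈ b + a
        φ[a+c] = φ-+-≈ φa≈b φc≈a

    orbitDet≉0 : ∀ {ψ a b c} → (∀ x → ψ x ≈ φ (φ x)) → φ a ≈ b → φ b ≈ c → φ c ≈ a →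
                 1# + 1# ≉ 0# → a ≉ 0# → b ≉ 0# → c ≉ 0# → orbitDet φ ψ a b c ≉ 0#
    orbitDet≉0 {ψ} {a} {b} {c} ψ≈φ² φa≈b φb≈c φc≈a 1+1≉0 a≉0 b≉0 c≉0 det≈0 =
      1+1≉0⇒x+x≉0 1+1≉0 (1+1≉0⇒x+x≉0 1+1≉0 X≉0)
        (trans (sym (orbitDet≈4[a+b][b+c][c+a] φa≈b φb≈c φc≈a ψ≈φ²)) det≈0)
      where
      X≉0 : (a + b) * ((b + c) * (c + a)) ≉ 0#
      X≉0 = x≉0∧y≉0⇒x*y≉0 (orbit-a+b≉0 φa≈b φb≈c φc≈a 1+1≉0 a≉0)
              (x≉0∧y≉0⇒x*y≉0 (orbit-a+b≉0 φb≈c φc≈a φa≈b 1+1≉0 b≉0)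
                              (orbit-a+b≉0 φc≈a φa≈b φb≈c 1+1≉0 c≉0))

  pow≈^ : ∀ x n → pow F x n ≈ x ^ n
  pow≈^ x zero    = refl
  pow≈^ x (suc n) = *-congˡ (pow≈^ x n)

  pow-* : ∀ x m n → pow F x (m ℕ.* n) ≈ pow F (pow F x m) n
  pow-* x m n = begin
    pow F x (m ℕ.* n)     ≈⟨ pow≈^ x (m ℕ.* n) ⟩
    x ^ (m ℕ.* n)         ≈⟨ ^-assocʳ x m n ⟨
    (x ^ m) ^ n           ≈⟨ ^-congˡ n (pow≈^ x m) ⟨
    pow F x m ^ n         ≈⟨ pow≈^ (pow F x m) n ⟨
    pow F (pow F x m) n   ∎

  module _ (q : ℕ) (^q-additive : Additive (_^ q)) where
    private
      φ : Op₁ Carrier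
      φ x = pow F x q

      φ-cong : Congruent₁ φ
      φ-cong {x} {y} x≈y = trans (pow≈^ x q) (trans (^-congˡ q x≈y) (sym (pow≈^ y q)))

      φ-additive : Additive φ
      φ-additive x y = begin
        pow F (x + y) q             ≈⟨ pow≈^ (x + y) q ⟩
        (x + y) ^ q                 ≈⟨ ^q-additive x y ⟩
        x ^ q + y ^ q               ≈⟨ +-cong (pow≈^ x q) (pow≈^ y q) ⟨
        pow F x q + pow F y q       ∎

      ψ≈φ² : ∀ x → pow F x (q ℕ.* q) ≈ φ (φ x)
      ψ≈φ² x = pow-* x q q

    detA≉0 : 1# + 1# ≉ 0# → ∀ {ε} → ε ^ (q ℕ.^ 3) ≈ ε → ε ≉ 0# → detA F q ε ≉ 0#
    detA≉0 1+1≉0 {ε} ε^q³≈ε ε≉0 =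
      orbitDet≉0 φ-cong φ-additive ψ≈φ² refl (sym (ψ≈φ² ε)) φ[ε^q²]≈ε 1+1≉0 ε≉0 (pow≉0 q) (pow≉0 (q ℕ.* q))
      where
      pow≉0 : ∀ n → pow F ε n ≉ 0#
      pow≉0 n = x≉0⇒x^n≉0 n ε≉0 ∘ trans (sym (pow≈^ ε n))
      φ[ε^q²]≈ε : φ (pow F ε (q ℕ.* q)) ≈ ε
      φ[ε^q²]≈ε = begin
        φ (pow F ε (q ℕ.* q))           ≈⟨ pow-* ε (q ℕ.* q) q ⟨
        pow F ε (q ℕ.* q ℕ.* q)         ≡⟨ ≡.cong (pow F ε) (n*n*n≡n^3 q) ⟩
        pow F ε (q ℕ.^ 3)               ≈⟨ pow≈^ ε (q ℕ.^ 3) ⟩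
        ε ^ (q ℕ.^ 3)                   ≈⟨ ε^q³≈ε ⟩
        ε                               ∎

open import Data.Nat using (ℕ; _^_; _≥_)

proposition2p3 : {c ℓ : Level} (F : Field c ℓ) (p k q : ℕ) →
    Prime p → p ≢ 2 → k ≥ 1 → q ≡ p ^ k → HasCard F (q ^ 3) →
    (ε : Field.Carrier F) → ¬ (Field._≈_ F ε (Field.0# F)) →
    ¬ (Field._≈_ F (detA F q ε) (Field.0# F))
proposition2p3 F p k q p-prime p≢2 _ ≡.refl card ε ε≉0 =
  detA≉0 q (^pᵏ-additive k) (1+1≉0 p≢2) (x^N≈x ε≉0) ε≉0
  where
  open FieldProperties F
  open Finite card
  open Characteristic p-prime (m^n≡N⇒m×1≈0 {p} {k ℕ.* 3} (≡.sym (^-*-assoc p k 3)))
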